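{- Let $G$ be a graph. Then for every subset $A\subseteq E(G)$, $\iota(G)\le \iota(G_A)\le \iota(G)+|A|$.
   Context: For $D\subseteq V(G)$, $N[D]$ is $D$ with all neighbours; $D$ is isolating if $G-N[D]$ has no edges; $\iota(G)$ is the minimum size of an isolating set. $G_A$ is obtained from $G$ by subdividing each edge of $A$ exactly once. -}

module Defs where

open import Data.Nat using (ℕ; _≤_)
open import Data.Fin using (Fin)
open import Data.Product using (Σ; _×_; _,_; proj₁; proj₂; ∃-syntax)
open import Data.Sum using (_⊎_; inj₁; inj₂)
open import Data.Empty using (⊥)
open import Data.List using (List; length; lookup)
open import Data.List.Relation.Unary.Any using (Any)
open import Data.List.Relation.Unary.All using (All)
open import Data.List.Relation.Unary.AllPairs using (AllPairs)
open import Data.List.Relation.Unary.Unique.Propositional using (Unique)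
open import Data.List.Membership.Propositional using (_∈_)
open import Relation.Binary.PropositionalEquality using (_≡_)
open import Relation.Nullary using (¬_)

record Graph (V : Set) : Set₁ where
  field
    _~_    : V → V → Set
    ~-sym  : ∀ {u v} → u ~ v → v ~ u
    ~-irr  : ∀ {u} → ¬ (u ~ u)
open Graph public

InClosedNbhd : {V : Set} → Graph V → List V → V → Set
InClosedNbhd G D v = Any (λ d → d ≡ v ⊎ _~_ G d v) D

-- D is isolating: G - N[D] has no edges, i.e. every edge meets N[D]
Isolating : {V : Set} → Graph V → List V → Set
Isolating G D = ∀ u v → _~_ G u v → InClosedNbhd G D u ⊎ InClosedNbhd G D v

-- ι(G) = k : k is the minimum size of an isolating set
-- (vertex sets are represented as duplicate-free lists; size = length)
IsIota : {V : Set} → Graph V → ℕ → Set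
IsIota {V} G k =
  (Σ (List V) λ D → Unique D × length D ≡ k × Isolating G D)
  × (∀ (D : List V) → Unique D → Isolating G D → k ≤ length D)

-- edges as ordered pairs, compared as unordered pairs
SameEdge : {V : Set} → V × V → V × V → Set
SameEdge (u , v) (x , y) = (u ≡ x × v ≡ y) ⊎ (u ≡ y × v ≡ x)

-- A set of edges of G: a list of edges of G, no edge listed twice
-- (in either orientation). |A| = length.
record EdgeSubset {V : Set} (G : Graph V) : Set where
  field
    edges    : List (V × V)
    areEdges : All (λ e → _~_ G (proj₁ e) (proj₂ e)) edges
    distinct : AllPairs (λ e f → ¬ SameEdge e f) edges
open EdgeSubset public

Endpoint : {V : Set} → V → V × V → Set
Endpoint u (x , y) = u ≡ x ⊎ u ≡ y

-- G_A: each edge of A subdivided once; the i-th edge of A gets new vertex inj₂ i.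
subAdj : {V : Set} (G : Graph V) (A : EdgeSubset G) →
         V ⊎ Fin (length (edges A)) → V ⊎ Fin (length (edges A)) → Set
subAdj G A (inj₁ u) (inj₁ v) = _~_ G u v × ¬ Any (SameEdge (u , v)) (edges A)
subAdj G A (inj₁ u) (inj₂ i) = Endpoint u (lookup (edges A) i)
subAdj G A (inj₂ i) (inj₁ u) = Endpoint u (lookup (edges A) i)
subAdj G A (inj₂ i) (inj₂ j) = ⊥

subAdj-sym : {V : Set} (G : Graph V) (A : EdgeSubset G) →
             ∀ {u v} → subAdj G A u v → subAdj G A v u
subAdj-sym G A {inj₁ u} {inj₁ v} (p , q) =
  ~-sym G p , λ a → q (Data.List.Relation.Unary.Any.map flipE a)
  where
    flipE : ∀ {e} → SameEdge (v , u) e → SameEdge (u , v) e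
    flipE (inj₁ (a , b)) = inj₂ (b , a)
    flipE (inj₂ (a , b)) = inj₁ (b , a)
subAdj-sym G A {inj₁ u} {inj₂ i} p = p
subAdj-sym G A {inj₂ i} {inj₁ u} p = p
subAdj-sym G A {inj₂ i} {inj₂ j} ()

subAdj-irr : {V : Set} (G : Graph V) (A : EdgeSubset G) →
             ∀ {u} → ¬ subAdj G A u u
subAdj-irr G A {inj₁ u} (p , _) = ~-irr G p
subAdj-irr G A {inj₂ i} ()

Subdivide : {V : Set} (G : Graph V) (A : EdgeSubset G) → Graph (V ⊎ Fin (length (edges A)))
Subdivide G A = record { _~_ = subAdj G A ; ~-sym = subAdj-sym G A ; ~-irr = subAdj-irr G A }

{-# OPTIONS --safe #-}
module Submission where

-- An isolating set D of G, together with all |A| subdivision vertices, isolates G_A: every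
-- edge of G_A either is an edge of G outside A, still covered by D, or ends in a
-- subdivision vertex.  Conversely, replacing each subdivision vertex of an isolating set of
-- G_A by an endpoint of its edge isolates G: an edge uv ∈ A becomes the path u – s – v, and
-- the set covers u – s either at u, which survives the replacement, or at s, in which case
-- s or a neighbour of s lies in the set, and either is turned into an endpoint of uv.

open import Defs
open import Data.Nat using (ℕ; _≤_; _+_)
open import Data.Fin using (Fin)
open import Data.Product using (_×_)
open import Data.List using (length)

open import Data.Nat.Properties using (≤-trans; module ≤-Reasoning)
open import Data.Product using (_,_; proj₁; proj₂; ∃)
open import Data.Sum as Sum using (_⊎_; inj₁; inj₂; [_,_]′)
open import Data.Sum.Properties using (≡-dec)
open import Data.List using (List; map; _++_; allFin; deduplicate; lookup)
open import Data.List.Properties using (length-++; length-map; length-tabulate; length-deduplicate)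
open import Data.List.Relation.Unary.Any as Any using (Any; index)
open import Data.List.Relation.Unary.Any.Properties as AnyP using (lookup-index; Any-⊎⁻)
import Data.List.Relation.Unary.All as All
open import Data.List.Membership.Propositional using (_∈_; find; lose)
open import Data.List.Membership.Propositional.Properties using (∈-map⁺; ∈-lookup; ∈-allFin)
open import Data.List.Relation.Unary.Unique.DecPropositional.Properties using (deduplicate-!)
import Data.Fin.Properties as Fin
open import Function using (_∘_; id)
open import Relation.Binary.Definitions using (DecidableEquality)
open import Relation.Binary.PropositionalEquality using (_≡_; refl; sym; cong; subst; module ≡-Reasoning)
open import Relation.Nullary using (Dec; yes; no)
open import Relation.Nullary.Decidable using (_×-dec_; _⊎-dec_)

sameEdge? : {V : Set} → DecidableEquality V → (e f : V × V) → Dec (SameEdge e f)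
sameEdge? _≟_ (u , v) (x , y) = ((u ≟ x) ×-dec (v ≟ y)) ⊎-dec ((u ≟ y) ×-dec (v ≟ x))

SameEdge⇒Endpoint₁ : {V : Set} {u v : V} {e : V × V} → SameEdge (u , v) e → Endpoint u e
SameEdge⇒Endpoint₁ (inj₁ (u≡x , _)) = inj₁ u≡x
SameEdge⇒Endpoint₁ (inj₂ (u≡y , _)) = inj₂ u≡y

SameEdge⇒Endpoint₂ : {V : Set} {u v : V} {e : V × V} → SameEdge (u , v) e → Endpoint v e
SameEdge⇒Endpoint₂ (inj₁ (_ , v≡y)) = inj₂ v≡y
SameEdge⇒Endpoint₂ (inj₂ (_ , v≡x)) = inj₁ v≡x

Endpoint-resp-SameEdge : {V : Set} {x : V} {e f : V × V} → SameEdge e f → Endpoint x f → Endpoint x e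
Endpoint-resp-SameEdge (inj₁ (refl , refl)) x∈f = x∈f
Endpoint-resp-SameEdge (inj₂ (refl , refl)) x∈f = Sum.swap x∈f

module _ {V : Set} (G : Graph V) where

  Any-Endpoint⇒InClosedNbhd : ∀ {D : List V} {u v} →
    Any (λ x → Endpoint x (u , v)) D → InClosedNbhd G D u ⊎ InClosedNbhd G D v
  Any-Endpoint⇒InClosedNbhd = Sum.map (Any.map inj₁) (Any.map inj₁) ∘ Any-⊎⁻

  module _ (_≟_ : DecidableEquality V) where

    deduplicate-isolating : ∀ {D : List V} → Isolating G D → Isolating G (deduplicate _≟_ D)
    deduplicate-isolating D-iso u v u~v = Sum.map dedup dedup (D-iso u v u~v)
      where
      dedup : ∀ {D w} → InClosedNbhd G D w → InClosedNbhd G (deduplicate _≟_ D) w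
      dedup = AnyP.deduplicate⁺ _≟_ λ { refl p → p }

    IsIota⇒≤length : ∀ {k} {D : List V} → IsIota G k → Isolating G D → k ≤ length D
    IsIota⇒≤length {D = D} (_ , minimal) D-iso =
      ≤-trans (minimal _ (deduplicate-! _≟_ D) (deduplicate-isolating D-iso))
              (length-deduplicate _≟_ D)

module Subdivision {V : Set} (_≟_ : DecidableEquality V) (G : Graph V) (A : EdgeSubset G) where

  open Graph G using () renaming (_~_ to _~ᴳ_)

  m : ℕ
  m = length (edges A)

  W : Set
  W = V ⊎ Fin m

  GA : Graph W
  GA = Subdivide G A

  edgeOf : Fin m → V × V
  edgeOf = lookup (edges A)

  edgeOf-adjacent : ∀ k → proj₁ (edgeOf k) ~ᴳ proj₂ (edgeOf k)
  edgeOf-adjacent k = All.lookup (areEdges A) (∈-lookup k)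

  edge-kept-or-subdivided : ∀ {u v} → u ~ᴳ v →
    subAdj G A (inj₁ u) (inj₁ v) ⊎ ∃ λ k → SameEdge (u , v) (edgeOf k)
  edge-kept-or-subdivided {u} {v} u~v with Any.any? (sameEdge? _≟_ (u , v)) (edges A)
  ... | no  uv∉A = inj₁ (u~v , uv∉A)
  ... | yes uv∈A = inj₂ (index uv∈A , lookup-index uv∈A)

  withSubdivisionVertices : List V → List W
  withSubdivisionVertices D = map inj₁ D ++ map inj₂ (allFin m)

  length-withSubdivisionVertices : ∀ D → length (withSubdivisionVertices D) ≡ length D + m
  length-withSubdivisionVertices D = begin
    length (map inj₁ D ++ map inj₂ (allFin m))          ≡⟨ length-++ (map inj₁ D) ⟩
    length (map inj₁ D) + length (map inj₂ (allFin m))  ≡⟨ cong (_+ length (map inj₂ (allFin m))) (length-map inj₁ D) ⟩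
    length D + length (map inj₂ (allFin m))             ≡⟨ cong (length D +_) (length-map inj₂ (allFin m)) ⟩
    length D + length (allFin m)                        ≡⟨ cong (length D +_) (length-tabulate id) ⟩
    length D + m                                        ∎
    where open ≡-Reasoning

  withSubdivisionVertices-isolating : ∀ {D} → Isolating G D → Isolating GA (withSubdivisionVertices D)
  withSubdivisionVertices-isolating {D} D-iso = isolating
    where
    D⁺ : List W
    D⁺ = withSubdivisionVertices D

    old∈D⁺ : ∀ {d} → d ∈ D → inj₁ d ∈ D⁺
    old∈D⁺ d∈D = AnyP.++⁺ˡ (∈-map⁺ inj₁ d∈D)

    new∈D⁺ : ∀ k → inj₂ k ∈ D⁺
    new∈D⁺ k = AnyP.++⁺ʳ (map inj₁ D) (∈-map⁺ inj₂ (∈-allFin k))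

    new-covered : ∀ k → InClosedNbhd GA D⁺ (inj₂ k)
    new-covered k = lose (new∈D⁺ k) (inj₁ refl)

    old-covered : ∀ {u} → InClosedNbhd G D u → InClosedNbhd GA D⁺ (inj₁ u)
    old-covered u∈N[D] with find u∈N[D]
    ... | d , d∈D , inj₁ refl = lose (old∈D⁺ d∈D) (inj₁ refl)
    ... | d , d∈D , inj₂ d~u with edge-kept-or-subdivided d~u
    ...   | inj₁ d~ᴬu        = lose (old∈D⁺ d∈D) (inj₂ d~ᴬu)
    ...   | inj₂ (k , du≈k) = lose (new∈D⁺ k) (inj₂ (SameEdge⇒Endpoint₂ du≈k))

    isolating : Isolating GA D⁺
    isolating (inj₂ k) _        _         = inj₁ (new-covered k)
    isolating (inj₁ u) (inj₂ k) _         = inj₂ (new-covered k)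
    isolating (inj₁ u) (inj₁ v) (u~v , _) = Sum.map old-covered old-covered (D-iso u v u~v)

  project : W → V
  project = [ id , proj₁ ∘ edgeOf ]′

  project-closedNbhd : ∀ {w d} → d ≡ inj₁ w ⊎ subAdj G A d (inj₁ w) → project d ≡ w ⊎ project d ~ᴳ w
  project-closedNbhd              (inj₁ refl)       = inj₁ refl
  project-closedNbhd {d = inj₁ x} (inj₂ (x~w , _))  = inj₂ x~w
  project-closedNbhd {d = inj₂ k} (inj₂ (inj₁ w≡x)) = inj₁ (sym w≡x)
  project-closedNbhd {d = inj₂ k} (inj₂ (inj₂ w≡y)) =
    inj₂ (subst (proj₁ (edgeOf k) ~ᴳ_) (sym w≡y) (edgeOf-adjacent k))

  project-subdivisionNbhd : ∀ {k d} → d ≡ inj₂ k ⊎ subAdj G A d (inj₂ k) → Endpoint (project d) (edgeOf k)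
  project-subdivisionNbhd              (inj₁ refl) = inj₁ refl
  project-subdivisionNbhd {d = inj₁ x} (inj₂ x∈e)  = x∈e
  project-subdivisionNbhd {d = inj₂ j} (inj₂ ())

  project-InClosedNbhd : ∀ {D w} → InClosedNbhd GA D (inj₁ w) → InClosedNbhd G (map project D) w
  project-InClosedNbhd = AnyP.map⁺ ∘ Any.map project-closedNbhd

  project-subdivision-InClosedNbhd : ∀ {D u v k} → SameEdge (u , v) (edgeOf k) →
    InClosedNbhd GA D (inj₂ k) → InClosedNbhd G (map project D) u ⊎ InClosedNbhd G (map project D) v
  project-subdivision-InClosedNbhd uv≈k =
    Any-Endpoint⇒InClosedNbhd G ∘ Any.map (Endpoint-resp-SameEdge uv≈k) ∘ AnyP.map⁺ ∘ Any.map project-subdivisionNbhd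

  project-isolating : ∀ {D} → Isolating GA D → Isolating G (map project D)
  project-isolating D-iso u v u~v with edge-kept-or-subdivided u~v
  ... | inj₁ u~ᴬv       = Sum.map project-InClosedNbhd project-InClosedNbhd (D-iso (inj₁ u) (inj₁ v) u~ᴬv)
  ... | inj₂ (k , uv≈k) = [ inj₁ ∘ project-InClosedNbhd , project-subdivision-InClosedNbhd uv≈k ]′
                            (D-iso (inj₁ u) (inj₂ k) (SameEdge⇒Endpoint₁ uv≈k))

corollary2p2 : (n : ℕ) (G : Graph (Fin n)) (A : EdgeSubset G) (i j : ℕ) →
    IsIota G i → IsIota (Subdivide G A) j → i ≤ j × j ≤ i + length (edges A)
corollary2p2 n G A i j ιG@((D , _ , |D|≡i , D-iso) , _) ιGA@((D′ , _ , |D′|≡j , D′-iso) , _) =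
  lower , upper
  where
  open Subdivision Fin._≟_ G A
  open ≤-Reasoning

  lower : i ≤ j
  lower = begin
    i                          ≤⟨ IsIota⇒≤length G Fin._≟_ ιG (project-isolating D′-iso) ⟩
    length (map project D′)    ≡⟨ length-map project D′ ⟩
    length D′                  ≡⟨ |D′|≡j ⟩
    j                          ∎

  upper : j ≤ i + m
  upper = begin
    j                                      ≤⟨ IsIota⇒≤length GA (≡-dec Fin._≟_ Fin._≟_) ιGA
                                                (withSubdivisionVertices-isolating D-iso) ⟩
    length (withSubdivisionVertices D)     ≡⟨ length-withSubdivisionVertices D ⟩
    length D + m                           ≡⟨ cong (_+ m) |D|≡i ⟩
    i + m                                  ∎
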